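{- For every formula $\rho\in\mathcal{L}$, the Lindenbaum algebra $\mathcal{L}_{\leftrightarrow}[\rho]$ is finite.
   Context: Fix a countable set $\mathcal{AP}$ of atomic propositions. Formulae of $\mathcal{L}$: $\varphi::= p\mid\neg\varphi\mid\varphi\wedge\varphi\mid L_r\varphi\mid M_r\varphi$ with $p\in\mathcal{AP}$, $r\in\mathbb{Q}_{\ge0}$ ($\to,\leftrightarrow,\vee,\bot$ defined as usual). Axiomatic system: $\vdash\varphi$ means $\varphi$ belongs to the smallest set of formulae containing all instances of propositional tautologies and of the axioms below, closed under modus ponens and the rules below (all $r,q\in\mathbb{Q}_{\ge0}$): (A1) $\neg L_0\bot$; (A2) $L_{r+q}\varphi\to L_r\varphi$ if $q>0$; (A2$'$) $M_r\varphi\to M_{r+q}\varphi$ if $q>0$; (A3) $L_r\varphi\wedge L_q\psi\to L_{\min\{r,q\}}(\varphi\vee\psi)$; (A3$'$) $M_r\varphi\wedge M_q\psi\to M_{\max\{r,q\}}(\varphi\vee\psi)$; (A4) $L_r(\varphi\vee\psi)\to L_r\varphi\vee L_r\psi$; (A5) $\neg L_0\psi\to(L_r\varphi\to L_r(\varphi\vee\psi))$; (A5$'$) $\neg L_0\psi\to(M_r\varphi\to M_r(\varphi\vee\psi))$; (A6) $L_{r+q}\varphi\to\neg M_r\varphi$ if $q>0$; (A7) $M_r\varphi\to L_0\varphi$; (R1) from $\vdash\varphi\to\psi$ infer $\vdash(L_r\psi\wedge L_0\varphi)\to L_r\varphi$; (R1$'$) from $\vdash\varphi\to\psi$ infer $\vdash(M_r\psi\wedge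 L_0\varphi)\to M_r\varphi$; (R2) from $\vdash\varphi\to\psi$ infer $\vdash L_0\varphi\to L_0\psi$. For a formula $\rho$: $Q_\rho\subseteq\mathbb{Q}_{\ge0}$ is the set of all $r$ such that $L_r$ or $M_r$ occurs in $\rho$; $\Sigma_\rho$ is the set of atomic propositions occurring in $\rho$; the granularity $gr(\rho)$ is the least common denominator of the elements of $Q_\rho$; the range is $R_\rho=\emptyset$ if $Q_\rho=\emptyset$, and otherwise $R_\rho=\{q\in\mathbb{Q}_{\ge0}\mid \exists j\in\mathbb{N},\ q=j/gr(\rho),\ \min Q_\rho\le q\le\max Q_\rho\}\cup\{0\}$; the modal depth $md$ is defined by $md(p)=0$, $md(\neg\varphi)=md(\varphi)$, $md(\varphi_1\wedge\varphi_2)=\max\{md(\varphi_1),md(\varphi_2)\}$, $md(L_r\varphi)=md(M_r\varphi)=1+md(\varphi)$. Let $\mathcal{L}[\rho]=\{\varphi\in\mathcal{L}\mid R_\varphi\subseteq R_\rho,\ md(\varphi)\le md(\rho),\ \Sigma_\varphi\subseteq\Sigma_\rho\}$, and let $\mathcal{L}_{\leftrightarrow}[\rho]$ be its Lindenbaum algebra: the quotient of $\mathcal{L}[\rho]$ by the equivalence $\varphi\equiv\psi$ iff $\vdash\varphi\leftrightarrow\psi$. -}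

module Defs where

open import Data.Nat as ℕ using (ℕ; zero; suc)
open import Data.Nat.LCM using (lcm; lcm-least)
open import Data.Nat.Divisibility using (_∣_; 0∣⇒≡0; m∣m*n; n∣m*n)
open import Data.Nat.Properties using (m*n≢0)
open import Data.Empty using (⊥; ⊥-elim)
open import Data.Integer using (+_)
open import Data.Rational as ℚ using (ℚ; 0ℚ; _/_; ↧ₙ_; _⊓_; _⊔_)
open import Data.Rational.Properties using (+-mono-≤; ⊓-sel; ⊔-sel)
open import Data.Bool using (Bool; true; false; not; _∧_)
open import Data.List using (List; []; _∷_; _++_)
open import Data.List.Membership.Propositional using (_∈_)
open import Data.Sum using (_⊎_; inj₁; inj₂)
open import Data.Product using (Σ; _×_; ∃-syntax)
open import Relation.Binary.PropositionalEquality using (_≡_; subst; sym)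

-- Nonnegative rationals ℚ≥0 (the nonnegativity proof is irrelevant, so
-- two elements are equal iff their underlying rationals are equal).

record ℚ⁺ : Set where
  constructor ⟨_,_⟩
  field
    val     : ℚ
    .nonneg : 0ℚ ℚ.≤ val
open ℚ⁺ public

0⁺ : ℚ⁺
0⁺ = ⟨ 0ℚ , ℚ.*≤* (Data.Integer.+≤+ ℕ.z≤n) ⟩

_+⁺_ : ℚ⁺ → ℚ⁺ → ℚ⁺
⟨ r , hr ⟩ +⁺ ⟨ q , hq ⟩ = ⟨ r ℚ.+ q , +-mono-≤ {0ℚ} {r} {0ℚ} {q} hr hq ⟩

⊓-nonneg : ∀ r q → 0ℚ ℚ.≤ r → 0ℚ ℚ.≤ q → 0ℚ ℚ.≤ r ⊓ q
⊓-nonneg r q hr hq with ⊓-sel r q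
... | inj₁ e = subst (0ℚ ℚ.≤_) (sym e) hr
... | inj₂ e = subst (0ℚ ℚ.≤_) (sym e) hq

⊔-nonneg : ∀ r q → 0ℚ ℚ.≤ r → 0ℚ ℚ.≤ q → 0ℚ ℚ.≤ r ⊔ q
⊔-nonneg r q hr hq with ⊔-sel r q
... | inj₁ e = subst (0ℚ ℚ.≤_) (sym e) hr
... | inj₂ e = subst (0ℚ ℚ.≤_) (sym e) hq

min⁺ : ℚ⁺ → ℚ⁺ → ℚ⁺
min⁺ ⟨ r , hr ⟩ ⟨ q , hq ⟩ = ⟨ r ⊓ q , ⊓-nonneg r q hr hq ⟩

max⁺ : ℚ⁺ → ℚ⁺ → ℚ⁺
max⁺ ⟨ r , hr ⟩ ⟨ q , hq ⟩ = ⟨ r ⊔ q , ⊔-nonneg r q hr hq ⟩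

AP : Set
AP = ℕ

infix 9 ¬'_
infixr 6 _∧'_
infixr 5 _∨'_
infixr 4 _⇒'_
infix 3 _⇔'_
infix 1 ⊢_
data Form : Set where
  atom : AP → Form
  ¬'_  : Form → Form
  _∧'_ : Form → Form → Form
  L    : ℚ⁺ → Form → Form
  M    : ℚ⁺ → Form → Form

_∨'_ : Form → Form → Form
φ ∨' ψ = ¬' (¬' φ ∧' ¬' ψ)

_⇒'_ : Form → Form → Form
φ ⇒' ψ = ¬' (φ ∧' ¬' ψ)

_⇔'_ : Form → Form → Form
φ ⇔' ψ = (φ ⇒' ψ) ∧' (ψ ⇒' φ)

⊥' : Form
⊥' = atom 0 ∧' ¬' atom 0

-- Propositional tautologies: true under every Boolean valuation of the
-- propositional "atoms", i.e. atomic propositions and modal formulas.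

eval : (Form → Bool) → Form → Bool
eval v (atom p) = v (atom p)
eval v (¬' φ)   = not (eval v φ)
eval v (φ ∧' ψ) = eval v φ ∧ eval v ψ
eval v (L r φ)  = v (L r φ)
eval v (M r φ)  = v (M r φ)

Tautology : Form → Set
Tautology φ = (v : Form → Bool) → eval v φ ≡ true

data ⊢_ : Form → Set where
  taut : ∀ {φ} → Tautology φ → ⊢ φ
  mp   : ∀ {φ ψ} → ⊢ (φ ⇒' ψ) → ⊢ φ → ⊢ ψ
  A1   : ⊢ (¬' L 0⁺ ⊥')
  A2   : ∀ {φ} r q → 0ℚ ℚ.< val q → ⊢ (L (r +⁺ q) φ ⇒' L r φ)
  A2'  : ∀ {φ} r q → 0ℚ ℚ.< val q → ⊢ (M r φ ⇒' M (r +⁺ q) φ)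
  A3   : ∀ {φ ψ} r q → ⊢ ((L r φ ∧' L q ψ) ⇒' L (min⁺ r q) (φ ∨' ψ))
  A3'  : ∀ {φ ψ} r q → ⊢ ((M r φ ∧' M q ψ) ⇒' M (max⁺ r q) (φ ∨' ψ))
  A4   : ∀ {φ ψ} r → ⊢ (L r (φ ∨' ψ) ⇒' (L r φ ∨' L r ψ))
  A5   : ∀ {φ ψ} r → ⊢ (¬' L 0⁺ ψ ⇒' (L r φ ⇒' L r (φ ∨' ψ)))
  A5'  : ∀ {φ ψ} r → ⊢ (¬' L 0⁺ ψ ⇒' (M r φ ⇒' M r (φ ∨' ψ)))
  A6   : ∀ {φ} r q → 0ℚ ℚ.< val q → ⊢ (L (r +⁺ q) φ ⇒' ¬' M r φ)
  A7   : ∀ {φ} r → ⊢ (M r φ ⇒' L 0⁺ φ)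
  R1   : ∀ {φ ψ} r → ⊢ (φ ⇒' ψ) → ⊢ ((L r ψ ∧' L 0⁺ φ) ⇒' L r φ)
  R1'  : ∀ {φ ψ} r → ⊢ (φ ⇒' ψ) → ⊢ ((M r ψ ∧' L 0⁺ φ) ⇒' M r φ)
  R2   : ∀ {φ ψ} → ⊢ (φ ⇒' ψ) → ⊢ (L 0⁺ φ ⇒' L 0⁺ ψ)

-- Q_ρ, as a list (with repetitions) of the indices occurring in ρ
Qs : Form → List ℚ
Qs (atom p) = []
Qs (¬' φ)   = Qs φ
Qs (φ ∧' ψ) = Qs φ ++ Qs ψ
Qs (L r φ)  = val r ∷ Qs φ
Qs (M r φ)  = val r ∷ Qs φ

-- Σ_ρ, as a list of the atomic propositions occurring in ρ
Atoms : Form → List AP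
Atoms (atom p) = p ∷ []
Atoms (¬' φ)   = Atoms φ
Atoms (φ ∧' ψ) = Atoms φ ++ Atoms ψ
Atoms (L r φ)  = Atoms φ
Atoms (M r φ)  = Atoms φ

md : Form → ℕ
md (atom p) = 0
md (¬' φ)   = md φ
md (φ ∧' ψ) = md φ ℕ.⊔ md ψ
md (L r φ)  = suc (md φ)
md (M r φ)  = suc (md φ)

-- least common denominator of a list of rationals (denominators reduced;
-- the empty list gets 1, which is irrelevant since then R_ρ = ∅)
lcd : List ℚ → ℕ
lcd []       = 1
lcd (q ∷ qs) = lcm (↧ₙ q) (lcd qs)

lcm-nonZero : ∀ m n → .{{ℕ.NonZero m}} → .{{ℕ.NonZero n}} → ℕ.NonZero (lcm m n)
lcm-nonZero m n with lcm m n in eq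
... | suc _ = _
... | zero  = ⊥-elim (ℕ.NonZero.nonZero (subst ℕ.NonZero m*n≡0 (m*n≢0 m n)))
  where
  m*n≡0 : m ℕ.* n ≡ 0
  m*n≡0 = 0∣⇒≡0 (subst (_∣ m ℕ.* n) eq (lcm-least {m} {n} (m∣m*n {m} n) (n∣m*n m {n})))

lcd-nonZero : ∀ qs → ℕ.NonZero (lcd qs)
lcd-nonZero []       = _
lcd-nonZero (q ∷ qs) = lcm-nonZero (↧ₙ q) (lcd qs) {{_}} {{lcd-nonZero qs}}

gr : Form → ℕ
gr ρ = lcd (Qs ρ)

minL : ℚ → List ℚ → ℚ
minL x []       = x
minL x (y ∷ ys) = x ⊓ minL y ys

maxL : ℚ → List ℚ → ℚ
maxL x []       = x
maxL x (y ∷ ys) = x ⊔ maxL y ys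

-- membership in the range R_ρ (R_ρ = ∅ when Q_ρ = ∅)
_∈R_ : ℚ → Form → Set
q ∈R ρ with Qs ρ
... | []     = ⊥
... | x ∷ xs = (q ≡ 0ℚ) ⊎
               (Σ ℕ λ j → (q ≡ ((+ j) / gr ρ) {{lcd-nonZero (Qs ρ)}}) × (minL x xs ℚ.≤ q) × (q ℚ.≤ maxL x xs))

_⊆R_ : Form → Form → Set
φ ⊆R ρ = ∀ q → q ∈R φ → q ∈R ρ

_⊆Σ_ : Form → Form → Set
φ ⊆Σ ρ = ∀ p → p ∈ Atoms φ → p ∈ Atoms ρ

InL[_] : Form → Form → Set
InL[ ρ ] φ = (φ ⊆R ρ) × (md φ ℕ.≤ md ρ) × (φ ⊆Σ ρ)

module Submission where

-- The argument is the usual normal-form induction on modal depth.  Fix finite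
-- lists S of atoms and J of indices and an atom b ∈ S.  A formula over S and J
-- of depth ≤ d is a Boolean combination of atoms and of formulas L_r ψ, M_r ψ
-- with r ∈ J and ψ of depth < d.  By induction each such ψ may be replaced by
-- one of finitely many representatives, since L_r and M_r respect provable
-- equivalence (R1/R1', R2, A2, A7); and a Boolean combination of finitely many
-- letters is tautologically equivalent to one of finitely many Shannon normal
-- forms, whose constants b ∧ ¬b and ¬(b ∧ ¬b) stay over S.
--
-- 𝓛[ρ] is not "all formulas over some J": it asks R_φ ⊆ R_ρ.  The indices of
-- φ ∈ 𝓛[ρ] lie in the finite set R_ρ, so J ranges over the sublists of R_ρ
-- whose own range lies in R_ρ, a decidable condition once ranges are computed
-- as explicit finite lists.

open import Defs
open import Data.Bool using (Bool; true; false; not; _∧_; if_then_else_)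
open import Data.Bool.Properties using (∧-inverseʳ)
open import Data.Nat as ℕ using (ℕ; zero; suc; z≤n; s≤s)
import Data.Nat.Properties as ℕP
open import Data.Nat.Divisibility using (_∣_; divides; ∣-trans; 1∣_)
open import Data.Nat.LCM using (lcm-least; m∣lcm[m,n]; n∣lcm[m,n])
open import Data.Integer as ℤ using (+_; -[1+_])
import Data.Integer.Properties as ℤP
open import Data.Rational as ℚ using (ℚ; 0ℚ; mkℚ; ↥_; ↧ₙ_; _/_)
import Data.Rational.Properties as ℚP
import Data.Rational.Unnormalised as ℚᵘ
import Data.Rational.Unnormalised.Properties as ℚᵘP
open import Data.List using (List; []; _∷_; _++_; map; filter; concatMap; cartesianProductWith; upTo)
open import Data.List.Relation.Unary.All as All using (All)
open import Data.List.Relation.Unary.Any using (Any; here; there)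
open import Data.List.Membership.Propositional using (_∈_; find; lose)
open import Data.List.Membership.Propositional.Properties
open import Data.List.Relation.Unary.Any.Properties using (¬Any[])
open import Data.List.Membership.DecPropositional ℚ._≟_ using (_∈?_)
open import Data.List.Relation.Binary.Subset.Propositional using (_⊆_)
open import Data.List.Relation.Binary.Subset.DecPropositional ℚ._≟_ using (_⊆?_)
open import Data.Product using (Σ; _×_; _,_; proj₁; proj₂)
open import Data.Sum using (_⊎_; inj₁; inj₂; [_,_])
open import Data.Empty using (⊥; ⊥-elim)
open import Function using (_∘_)
open import Relation.Nullary using (yes; no)
open import Relation.Nullary.Decidable using (recompute; _×-dec_)
open import Relation.Unary using (Decidable)
open import Relation.Binary.PropositionalEquality hiding ([_])

Holds : (Form → Bool) → Form → Set
Holds v φ = eval v φ ≡ true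

⇒-intro : ∀ {v a b} → (Holds v a → Holds v b) → Holds v (a ⇒' b)
⇒-intro {v} {a} {b} = table (eval v a) (eval v b)
  where
  table : ∀ x y → (x ≡ true → y ≡ true) → not (x ∧ not y) ≡ true
  table false _ _ = refl
  table true  y h rewrite h refl = refl

⇒-elim : ∀ {v a b} → Holds v (a ⇒' b) → Holds v a → Holds v b
⇒-elim {v} {a} {b} = table (eval v a) (eval v b)
  where
  table : ∀ x y → not (x ∧ not y) ≡ true → x ≡ true → y ≡ true
  table true  true  _  _ = refl
  table true  false () _
  table false _     _  ()

⇔-intro : ∀ {v a b} → eval v a ≡ eval v b → Holds v (a ⇔' b)
⇔-intro {v} {a} {b} = table (eval v a) (eval v b)
  where
  table : ∀ x y → x ≡ y → not (x ∧ not y) ∧ not (y ∧ not x) ≡ true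
  table true  _ refl = refl
  table false _ refl = refl

⇔-elim : ∀ {v a b} → Holds v (a ⇔' b) → eval v a ≡ eval v b
⇔-elim {v} {a} {b} = table (eval v a) (eval v b)
  where
  table : ∀ x y → not (x ∧ not y) ∧ not (y ∧ not x) ≡ true → x ≡ y
  table true  true  _  = refl
  table true  false ()
  table false true  ()
  table false false _  = refl

infer₁ : ∀ {a c} → (∀ v → Holds v a → Holds v c) → ⊢ a → ⊢ c
infer₁ {a} {c} h ⊢a = mp (taut λ v → ⇒-intro {v} {a} {c} (h v)) ⊢a

infer₂ : ∀ {a b c} → (∀ v → Holds v a → Holds v b → Holds v c) → ⊢ a → ⊢ b → ⊢ c
infer₂ {a} {b} {c} h ⊢a ⊢b =
  mp (mp (taut λ v → ⇒-intro {v} {a} {b ⇒' c} λ ha → ⇒-intro {v} {b} {c} (h v ha)) ⊢a) ⊢b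

tautEquiv : ∀ {a b} → (∀ v → eval v a ≡ eval v b) → ⊢ (a ⇔' b)
tautEquiv {a} {b} h = taut λ v → ⇔-intro {v} {a} {b} (h v)

⇔-refl : ∀ {a} → ⊢ (a ⇔' a)
⇔-refl = tautEquiv λ _ → refl

⇔-sym : ∀ {a b} → ⊢ (a ⇔' b) → ⊢ (b ⇔' a)
⇔-sym {a} {b} = infer₁ λ v e → ⇔-intro {v} {b} {a} (sym (⇔-elim {v} {a} {b} e))

⇔-trans : ∀ {a b c} → ⊢ (a ⇔' b) → ⊢ (b ⇔' c) → ⊢ (a ⇔' c)
⇔-trans {a} {b} {c} = infer₂ λ v e f →
  ⇔-intro {v} {a} {c} (trans (⇔-elim {v} {a} {b} e) (⇔-elim {v} {b} {c} f))

⇔-¬ : ∀ {a b} → ⊢ (a ⇔' b) → ⊢ (¬' a ⇔' ¬' b)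
⇔-¬ {a} {b} = infer₁ λ v e → ⇔-intro {v} {¬' a} {¬' b} (cong not (⇔-elim {v} {a} {b} e))

⇔-∧ : ∀ {a b c d} → ⊢ (a ⇔' b) → ⊢ (c ⇔' d) → ⊢ ((a ∧' c) ⇔' (b ∧' d))
⇔-∧ {a} {b} {c} {d} = infer₂ λ v e f →
  ⇔-intro {v} {a ∧' c} {b ∧' d} (cong₂ _∧_ (⇔-elim {v} {a} {b} e) (⇔-elim {v} {c} {d} f))

⇔⇒⇒ : ∀ {a b} → ⊢ (a ⇔' b) → ⊢ (a ⇒' b)
⇔⇒⇒ {a} {b} = infer₁ λ v e → ⇒-intro {v} {a} {b} (trans (sym (⇔-elim {v} {a} {b} e)))

⇒-antisym : ∀ {a b} → ⊢ (a ⇒' b) → ⊢ (b ⇒' a) → ⊢ (a ⇔' b)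
⇒-antisym = infer₂ λ _ f g → cong₂ _∧_ f g

⇒-refl : ∀ {a} → ⊢ (a ⇒' a)
⇒-refl {a} = taut λ v → ⇒-intro {v} {a} {a} λ h → h

⇒-trans : ∀ {a b c} → ⊢ (a ⇒' b) → ⊢ (b ⇒' c) → ⊢ (a ⇒' c)
⇒-trans {a} {b} {c} = infer₂ λ v f g → ⇒-intro {v} {a} {c} (⇒-elim {v} {b} {c} g ∘ ⇒-elim {v} {a} {b} f)

⇒-discharge : ∀ {a b c} → ⊢ ((a ∧' b) ⇒' c) → ⊢ (a ⇒' b) → ⊢ (a ⇒' c)
⇒-discharge {a} {b} {c} = infer₂ λ v f g →
  ⇒-intro {v} {a} {c} λ ha → ⇒-elim {v} {a ∧' b} {c} f (cong₂ _∧_ ha (⇒-elim {v} {a} {b} g ha))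

ℚ⁺-ext : ∀ {r s : ℚ⁺} → val r ≡ val s → r ≡ s
ℚ⁺-ext {⟨ x , _ ⟩} {⟨ .x , _ ⟩} refl = refl

val-nonneg : ∀ r → 0ℚ ℚ.≤ val r
val-nonneg ⟨ x , h ⟩ = recompute (0ℚ ℚP.≤? x) h

-- L_r ψ → L_0 ψ: axiom A2 when r > 0, and trivial when r = 0.
L⇒L₀ : ∀ r {ψ} → ⊢ (L r ψ ⇒' L 0⁺ ψ)
L⇒L₀ r {ψ} with 0ℚ ℚP.<? val r
... | yes r>0 = subst (λ s → ⊢ (L s ψ ⇒' L 0⁺ ψ)) (ℚ⁺-ext (ℚP.+-identityˡ (val r))) (A2 0⁺ r r>0)
... | no  r≯0 = subst (λ s → ⊢ (L s ψ ⇒' L 0⁺ ψ)) (ℚ⁺-ext r=0) ⇒-refl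
  where
  r=0 : 0ℚ ≡ val r
  r=0 = ℚP.≤-antisym (val-nonneg r) (ℚP.≮⇒≥ r≯0)

-- Any operator O that obeys the rule shape of R1/R1' and implies L_0 respects
-- provable equivalence: from φ ⇔ ψ, the rule gives (O ψ ∧ L_0 φ) → O φ, and the
-- conjunct L_0 φ follows from O ψ via L_0 ψ and R2.
modal-cong : (O : Form → Form) →
             (∀ {φ ψ} → ⊢ (φ ⇒' ψ) → ⊢ ((O ψ ∧' L 0⁺ φ) ⇒' O φ)) →
             (∀ {φ} → ⊢ (O φ ⇒' L 0⁺ φ)) →
             ∀ {φ ψ} → ⊢ (φ ⇔' ψ) → ⊢ (O φ ⇔' O ψ)
modal-cong O rule O⇒L₀ e = ⇒-antisym (one-way e) (one-way (⇔-sym e))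
  where
  one-way : ∀ {φ ψ} → ⊢ (φ ⇔' ψ) → ⊢ (O φ ⇒' O ψ)
  one-way e = ⇒-discharge (rule (⇔⇒⇒ (⇔-sym e))) (⇒-trans O⇒L₀ (R2 (⇔⇒⇒ e)))

L-cong : ∀ r {φ ψ} → ⊢ (φ ⇔' ψ) → ⊢ (L r φ ⇔' L r ψ)
L-cong r = modal-cong (L r) (λ h → R1 r h) (L⇒L₀ r)

M-cong : ∀ r {φ ψ} → ⊢ (φ ⇔' ψ) → ⊢ (M r φ ⇔' M r ψ)
M-cong r = modal-cong (M r) (λ h → R1' r h) (A7 r)

-- Boolean combinations of a finite list of "letters" (arbitrary formulas) are,
-- up to tautological equivalence, among finitely many normal forms.
module NormalForms (f : Form) where

  constant : Bool → Form
  constant true  = ¬' (f ∧' ¬' f)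
  constant false = f ∧' ¬' f

  eval-constant : ∀ v c → eval v (constant c) ≡ c
  eval-constant v true  = cong not (∧-inverseʳ (eval v f))
  eval-constant v false = ∧-inverseʳ (eval v f)

  data Term (U : List Form) : Set where
    var : ∀ {a} → a ∈ U → Term U
    lit : Bool → Term U
    neg : Term U → Term U
    and : Term U → Term U → Term U

  ⟦_⟧ : ∀ {U} → Term U → Form
  ⟦ var {a} _ ⟧ = a
  ⟦ lit c ⟧     = constant c
  ⟦ neg s ⟧     = ¬' ⟦ s ⟧
  ⟦ and s t ⟧   = ⟦ s ⟧ ∧' ⟦ t ⟧

  restrict : ∀ {a U} → Bool → Term (a ∷ U) → Term U
  restrict c (var (here _))  = lit c
  restrict c (var (there a)) = var a
  restrict c (lit d)         = lit d
  restrict c (neg s)         = neg (restrict c s)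
  restrict c (and s t)       = and (restrict c s) (restrict c t)

  restrict-sound : ∀ {a U} v {c} → eval v a ≡ c → (s : Term (a ∷ U)) →
                   eval v ⟦ s ⟧ ≡ eval v ⟦ restrict c s ⟧
  restrict-sound v e (var (here refl)) = trans e (sym (eval-constant v _))
  restrict-sound v e (var (there _))   = refl
  restrict-sound v e (lit _)           = refl
  restrict-sound v e (neg s)           = cong not (restrict-sound v e s)
  restrict-sound v e (and s t)         = cong₂ _∧_ (restrict-sound v e s) (restrict-sound v e t)

  expand : ∀ {a U} v (s : Term (a ∷ U)) →
           eval v ⟦ s ⟧ ≡ (if eval v a then eval v ⟦ restrict true s ⟧ else eval v ⟦ restrict false s ⟧)
  expand {a} v s with eval v a in e
  ... | true  = restrict-sound v e s
  ... | false = restrict-sound v e s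

  value : Term [] → Bool
  value (lit c)   = c
  value (neg s)   = not (value s)
  value (and s t) = value s ∧ value t

  value-sound : ∀ v (s : Term []) → eval v ⟦ s ⟧ ≡ value s
  value-sound v (lit c)   = eval-constant v c
  value-sound v (neg s)   = cong not (value-sound v s)
  value-sound v (and s t) = cong₂ _∧_ (value-sound v s) (value-sound v t)

  ite : Form → Form → Form → Form
  ite a x y = (a ∧' x) ∨' (¬' a ∧' y)

  eval-ite : ∀ v a x y → eval v (ite a x y) ≡ (if eval v a then eval v x else eval v y)
  eval-ite v a x y = mux (eval v a) (eval v x) (eval v y)
    where
    mux : ∀ a x y → not (not (a ∧ x) ∧ not (not a ∧ y)) ≡ (if a then x else y)
    mux true  true  _     = refl
    mux true  false _     = refl
    mux false _     true  = refl
    mux false _     false = refl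

  shannon : List Form → List Form
  shannon []      = constant true ∷ constant false ∷ []
  shannon (a ∷ U) = cartesianProductWith (ite a) (shannon U) (shannon U)

  constant∈shannon : ∀ c → constant c ∈ shannon []
  constant∈shannon true  = here refl
  constant∈shannon false = there (here refl)

  normalise : ∀ U (s : Term U) → Σ Form λ ψ → ψ ∈ shannon U × (∀ v → eval v ⟦ s ⟧ ≡ eval v ψ)
  normalise [] s =
    constant (value s) , constant∈shannon (value s) ,
    λ v → trans (value-sound v s) (sym (eval-constant v (value s)))
  normalise (a ∷ U) s =
    let ψ₁ , ψ₁∈ , s₁≗ψ₁ = normalise U (restrict true s)
        ψ₀ , ψ₀∈ , s₀≗ψ₀ = normalise U (restrict false s)
    in ite a ψ₁ ψ₀ , ∈-cartesianProductWith⁺ (ite a) ψ₁∈ ψ₀∈ ,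
       λ v → trans (expand v s)
               (trans (cong₂ (if_then_else_ (eval v a)) (s₁≗ψ₁ v) (s₀≗ψ₀ v))
                      (sym (eval-ite v a ψ₁ ψ₀)))

  shannon-closed : (P : Form → Set) →
                   (∀ {a} → P a → P (¬' a)) → (∀ {a b} → P a → P b → P (a ∧' b)) → P f →
                   ∀ U → (∀ {a} → a ∈ U → P a) → ∀ {ψ} → ψ ∈ shannon U → P ψ
  shannon-closed P P¬ P∧ Pf [] _ (here refl)         = P¬ (P∧ Pf (P¬ Pf))
  shannon-closed P P¬ P∧ Pf [] _ (there (here refl)) = P∧ Pf (P¬ Pf)
  shannon-closed P P¬ P∧ Pf (a ∷ U) PU ψ∈
    with x , y , x∈ , y∈ , refl ← ∈-cartesianProductWith⁻ (ite a) (shannon U) (shannon U) ψ∈ =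
    P¬ (P∧ (P¬ (P∧ Pa (IH x∈))) (P¬ (P∧ (P¬ Pa) (IH y∈))))
    where
    Pa : P a
    Pa = PU (here refl)
    IH : ∀ {ψ} → ψ ∈ shannon U → P ψ
    IH = shannon-closed P P¬ P∧ Pf U (PU ∘ there)

module Representatives (S : List AP) (J : List ℚ⁺) (b : AP) (b∈S : b ∈ S) where

  open NormalForms (atom b)

  record Within (d : ℕ) (φ : Form) : Set where
    constructor within
    field
      atoms⊆   : Atoms φ ⊆ S
      indices⊆ : Qs φ ⊆ map val J
      depth≤   : md φ ℕ.≤ d

  within-atom : ∀ {d p} → p ∈ S → Within d (atom p)
  within-atom p∈S = within (λ { (here refl) → p∈S }) (λ ()) z≤n

  within-¬ : ∀ {d φ} → Within d φ → Within d (¬' φ)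
  within-¬ (within a q m) = within a q m

  within-∧ : ∀ {d φ ψ} → Within d φ → Within d ψ → Within d (φ ∧' ψ)
  within-∧ {φ = φ} (within aφ qφ mφ) (within aψ qψ mψ) =
    within ([ aφ , aψ ] ∘ ∈-++⁻ (Atoms φ)) ([ qφ , qψ ] ∘ ∈-++⁻ (Qs φ)) (ℕP.⊔-lub mφ mψ)

  within-∧ˡ : ∀ {d φ ψ} → Within d (φ ∧' ψ) → Within d φ
  within-∧ˡ {φ = φ} {ψ} (within a q m) = within (a ∘ ∈-++⁺ˡ) (q ∘ ∈-++⁺ˡ) (ℕP.m⊔n≤o⇒m≤o (md φ) (md ψ) m)

  within-∧ʳ : ∀ {d φ ψ} → Within d (φ ∧' ψ) → Within d ψ
  within-∧ʳ {φ = φ} {ψ} (within a q m) =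
    within (a ∘ ∈-++⁺ʳ (Atoms φ)) (q ∘ ∈-++⁺ʳ (Qs φ)) (ℕP.m⊔n≤o⇒n≤o (md φ) (md ψ) m)

  modal-indices : ∀ {r qs} → r ∈ J → qs ⊆ map val J → (val r ∷ qs) ⊆ map val J
  modal-indices r∈J qψ (here refl) = ∈-map⁺ val r∈J
  modal-indices r∈J qψ (there k)   = qψ k

  index∈J : ∀ {r} → val r ∈ map val J → r ∈ J
  index∈J r∈ with r' , r'∈J , e ← ∈-map⁻ val r∈ = subst (_∈ J) (sym (ℚ⁺-ext e)) r'∈J

  within-L : ∀ {d r ψ} → r ∈ J → Within d ψ → Within (suc d) (L r ψ)
  within-L r∈J (within a q m) = within a (modal-indices r∈J q) (s≤s m)

  within-M : ∀ {d r ψ} → r ∈ J → Within d ψ → Within (suc d) (M r ψ)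
  within-M r∈J (within a q m) = within a (modal-indices r∈J q) (s≤s m)

  within-L⁻ : ∀ {d r ψ} → Within (suc d) (L r ψ) → r ∈ J × Within d ψ
  within-L⁻ (within a q (s≤s m)) = index∈J (q (here refl)) , within a (q ∘ there) m

  within-M⁻ : ∀ {d r ψ} → Within (suc d) (M r ψ) → r ∈ J × Within d ψ
  within-M⁻ (within a q (s≤s m)) = index∈J (q (here refl)) , within a (q ∘ there) m

  mutual
    Letters : ℕ → List Form
    Letters zero    = map atom S
    Letters (suc d) = map atom S ++ cartesianProductWith L J (Reps d) ++ cartesianProductWith M J (Reps d)

    Reps : ℕ → List Form
    Reps d = shannon (Letters d)

  mutual
    letters-within : ∀ d {ψ} → ψ ∈ Letters d → Within d ψ
    letters-within zero ψ∈ with p , p∈S , refl ← ∈-map⁻ atom ψ∈ = within-atom p∈S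
    letters-within (suc d) ψ∈ with ∈-++⁻ (map atom S) ψ∈
    ... | inj₁ ψ∈atoms with p , p∈S , refl ← ∈-map⁻ atom ψ∈atoms = within-atom p∈S
    ... | inj₂ ψ∈modal with ∈-++⁻ (cartesianProductWith L J (Reps d)) ψ∈modal
    ...   | inj₁ ψ∈L with r , χ , r∈J , χ∈ , refl ← ∈-cartesianProductWith⁻ L J (Reps d) ψ∈L =
      within-L r∈J (reps-within d χ∈)
    ...   | inj₂ ψ∈M with r , χ , r∈J , χ∈ , refl ← ∈-cartesianProductWith⁻ M J (Reps d) ψ∈M =
      within-M r∈J (reps-within d χ∈)

    reps-within : ∀ d {ψ} → ψ ∈ Reps d → Within d ψ
    reps-within d = shannon-closed (Within d) within-¬ within-∧ (within-atom b∈S) (Letters d) (letters-within d)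

  atom∈Letters : ∀ d {p} → p ∈ S → atom p ∈ Letters d
  atom∈Letters zero    p∈S = ∈-map⁺ atom p∈S
  atom∈Letters (suc d) p∈S = ∈-++⁺ˡ (∈-map⁺ atom p∈S)

  L∈Letters : ∀ d {r ψ} → r ∈ J → ψ ∈ Reps d → L r ψ ∈ Letters (suc d)
  L∈Letters d r∈J ψ∈ = ∈-++⁺ʳ (map atom S) (∈-++⁺ˡ (∈-cartesianProductWith⁺ L r∈J ψ∈))

  M∈Letters : ∀ d {r ψ} → r ∈ J → ψ ∈ Reps d → M r ψ ∈ Letters (suc d)
  M∈Letters d r∈J ψ∈ =
    ∈-++⁺ʳ (map atom S) (∈-++⁺ʳ (cartesianProductWith L J (Reps d)) (∈-cartesianProductWith⁺ M r∈J ψ∈))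

  mutual
    -- A formula within depth d is provably equivalent to a Boolean term over
    -- the letters of depth d: modal subformulas are replaced by
    -- representatives of their arguments, using L-cong and M-cong.
    toTerm : ∀ d φ → Within d φ → Σ (Term (Letters d)) λ s → ⊢ (φ ⇔' ⟦ s ⟧)
    toTerm d (atom p) (within a _ _) = var (atom∈Letters d (a (here refl))) , ⇔-refl
    toTerm d (¬' φ) (within a q m) = let s , e = toTerm d φ (within a q m) in neg s , ⇔-¬ e
    toTerm d (φ ∧' ψ) w =
      let s , e = toTerm d φ (within-∧ˡ w)
          t , e' = toTerm d ψ (within-∧ʳ {φ = φ} w)
      in and s t , ⇔-∧ e e'
    toTerm zero (L r ψ) (within _ _ ())
    toTerm zero (M r ψ) (within _ _ ())
    toTerm (suc d) (L r ψ) w =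
      let r∈J , wψ = within-L⁻ w
          ψ' , ψ'∈ , e = represent d ψ wψ
      in var (L∈Letters d r∈J ψ'∈) , L-cong r e
    toTerm (suc d) (M r ψ) w =
      let r∈J , wψ = within-M⁻ w
          ψ' , ψ'∈ , e = represent d ψ wψ
      in var (M∈Letters d r∈J ψ'∈) , M-cong r e

    represent : ∀ d φ → Within d φ → Σ Form λ ψ → ψ ∈ Reps d × (⊢ (φ ⇔' ψ))
    represent d φ w =
      let s , φ⇔s = toTerm d φ w
          ψ , ψ∈ , s≗ψ = normalise (Letters d) s
      in ψ , ψ∈ , ⇔-trans φ⇔s (tautEquiv s≗ψ)

frac : ℕ → List ℚ → ℚ
frac j A = ((+ j) / lcd A) {{lcd-nonZero A}}

InRange : List ℚ → ℚ → Set
InRange []       q = ⊥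
InRange (x ∷ xs) q = (q ≡ 0ℚ) ⊎ (Σ ℕ λ j → (q ≡ frac j (x ∷ xs)) × (minL x xs ℚ.≤ q) × (q ℚ.≤ maxL x xs))

∈R⇒InRange : ∀ φ q → q ∈R φ → InRange (Qs φ) q
∈R⇒InRange φ q h with Qs φ in eq
... | []     = h
... | x ∷ xs = [ inj₁ , (λ (j , e , lo , hi) → inj₂ (j , trans e (cong (frac j) eq) , lo , hi)) ] h

InRange⇒∈R : ∀ φ q → InRange (Qs φ) q → q ∈R φ
InRange⇒∈R φ q h with Qs φ in eq
... | []     = h
... | x ∷ xs = [ inj₁ , (λ (j , e , lo , hi) → inj₂ (j , trans e (cong (frac j) (sym eq)) , lo , hi)) ] h

minL≤ : ∀ x xs {y} → y ∈ x ∷ xs → minL x xs ℚ.≤ y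
minL≤ x []       (here refl) = ℚP.≤-refl
minL≤ x (z ∷ zs) (here refl) = ℚP.p⊓q≤p x (minL z zs)
minL≤ x (z ∷ zs) (there y∈)  = ℚP.≤-trans (ℚP.p⊓q≤q x (minL z zs)) (minL≤ z zs y∈)

≤maxL : ∀ x xs {y} → y ∈ x ∷ xs → y ℚ.≤ maxL x xs
≤maxL x []       (here refl) = ℚP.≤-refl
≤maxL x (z ∷ zs) (here refl) = ℚP.p≤p⊔q x (maxL z zs)
≤maxL x (z ∷ zs) (there y∈)  = ℚP.≤-trans (≤maxL z zs y∈) (ℚP.p≤q⊔p x (maxL z zs))

minL∈ : ∀ x xs → minL x xs ∈ x ∷ xs
minL∈ x []       = here refl
minL∈ x (z ∷ zs) with ℚP.⊓-sel x (minL z zs)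
... | inj₁ e = here e
... | inj₂ e = there (subst (_∈ z ∷ zs) (sym e) (minL∈ z zs))

maxL∈ : ∀ x xs → maxL x xs ∈ x ∷ xs
maxL∈ x []       = here refl
maxL∈ x (z ∷ zs) with ℚP.⊔-sel x (maxL z zs)
... | inj₁ e = here e
... | inj₂ e = there (subst (_∈ z ∷ zs) (sym e) (maxL∈ z zs))

↧∣lcd : ∀ {A y} → y ∈ A → ↧ₙ y ∣ lcd A
↧∣lcd {x ∷ xs} (here refl) = m∣lcm[m,n] (↧ₙ x) (lcd xs)
↧∣lcd {x ∷ xs} (there y∈)  = ∣-trans (↧∣lcd y∈) (n∣lcm[m,n] (↧ₙ x) (lcd xs))

lcd-least : ∀ {A n} → (∀ {y} → y ∈ A → ↧ₙ y ∣ n) → lcd A ∣ n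
lcd-least {[]}     {n} _ = 1∣ n
lcd-least {x ∷ xs}     h = lcm-least (h (here refl)) (lcd-least (h ∘ there))

frac-cross : ∀ a b c d .{{_ : ℕ.NonZero c}} .{{_ : ℕ.NonZero d}} →
             a ℕ.* d ≡ b ℕ.* c → (+ a) / c ≡ (+ b) / d
frac-cross a b (suc c) (suc d) e =
  ℚP.fromℚᵘ-cong {ℚᵘ.mkℚᵘ (+ a) c} {ℚᵘ.mkℚᵘ (+ b) d}
    (ℚᵘ.*≡* (trans (sym (ℤP.pos-* a (suc d))) (trans (cong +_ e) (ℤP.pos-* b (suc c)))))

frac-rescale : ∀ j A B → lcd A ∣ lcd B → Σ ℕ λ j' → frac j A ≡ frac j' B
frac-rescale j A B (divides k eq) =
  j ℕ.* k ,
  frac-cross j (j ℕ.* k) (lcd A) (lcd B) {{lcd-nonZero A}} {{lcd-nonZero B}}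
    (trans (cong (j ℕ.*_) eq) (sym (ℕP.*-assoc j k (lcd A))))

-- Ranges are monotone: a larger index list has a finer granularity and a
-- wider interval [min, max].
InRange-mono : ∀ {A B q} → A ⊆ B → InRange A q → InRange B q
InRange-mono {[]}                 _   ()
InRange-mono {x ∷ xs} {[]}        A⊆B _ = ⊥-elim (¬Any[] (A⊆B (here refl)))
InRange-mono {x ∷ xs} {y ∷ ys}    _   (inj₁ q≡0) = inj₁ q≡0
InRange-mono {x ∷ xs} {y ∷ ys} {q} A⊆B (inj₂ (j , q≡ , lo , hi)) =
  rescaled (frac-rescale j (x ∷ xs) (y ∷ ys) (lcd-least (↧∣lcd ∘ A⊆B)))
  where
  rescaled : (Σ ℕ λ j' → frac j (x ∷ xs) ≡ frac j' (y ∷ ys)) → InRange (y ∷ ys) q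
  rescaled (j' , e) = inj₂ (j' , trans q≡ e , ℚP.≤-trans (minL≤ y ys (A⊆B (minL∈ x xs))) lo ,
                                              ℚP.≤-trans hi (≤maxL y ys (A⊆B (maxL∈ x xs))))

-- Every nonnegative index lies in the range of its list: it is n/(d+1) with
-- d+1 dividing the granularity.
InRange-self : ∀ {A x} → 0ℚ ℚ.≤ x → x ∈ A → InRange A x
InRange-self {[]} _ ()
InRange-self {a ∷ as} {x@(mkℚ (+ n) d _)} _ x∈ = scaled (↧∣lcd x∈)
  where
  scaled : suc d ∣ lcd (a ∷ as) → InRange (a ∷ as) x
  scaled (divides k eq) = inj₂ (n ℕ.* k , x≡ , minL≤ a as x∈ , ≤maxL a as x∈)
    where
    x≡ : x ≡ frac (n ℕ.* k) (a ∷ as)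
    x≡ = trans (sym (ℚP.↥p/↧p≡p x))
               (frac-cross n (n ℕ.* k) (suc d) (lcd (a ∷ as)) {{_}} {{lcd-nonZero (a ∷ as)}}
                 (trans (cong (n ℕ.*_) eq) (sym (ℕP.*-assoc n k (suc d)))))
InRange-self {a ∷ as} {mkℚ -[1+ _ ] _ _} (ℚ.*≤* ()) _

frac-bound : ∀ j g .{{_ : ℕ.NonZero g}} m → (+ j) / g ℚ.≤ m → j ℕ.≤ ℤ.∣ ↥ m ∣ ℕ.* g
frac-bound j (suc g) m le =
  cross-bound m (ℚᵘP.≤-respˡ-≃ (ℚP.toℚᵘ-fromℚᵘ (ℚᵘ.mkℚᵘ (+ j) g)) (ℚP.toℚᵘ-mono-≤ le))
  where
  -- j/(g+1) ≤ a/(d+1) unfolds to j·(d+1) ≤ a·(g+1), and a cannot be negative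
  cross-bound : ∀ m → ℚᵘ.mkℚᵘ (+ j) g ℚᵘ.≤ ℚ.toℚᵘ m → j ℕ.≤ ℤ.∣ ↥ m ∣ ℕ.* suc g
  cross-bound (mkℚ (+ a) d _) (ℚᵘ.*≤* h) =
    ℕP.≤-trans (ℕP.m≤m*n j (suc d))
      (ℤP.drop‿+≤+ (subst₂ ℤ._≤_ (sym (ℤP.pos-* j (suc d))) (sym (ℤP.pos-* a (suc g))) h))
  cross-bound (mkℚ -[1+ a ] d _) (ℚᵘ.*≤* h) with subst (ℤ._≤ _) (sym (ℤP.pos-* j (suc d))) h
  ... | ()

-- The range as an explicit finite list: 0, and the multiples of 1/gr(A)
-- between min A and max A (their numerators are bounded by frac-bound).
Between : ℚ → List ℚ → ℚ → Set
Between x xs q = minL x xs ℚ.≤ q × q ℚ.≤ maxL x xs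

between? : ∀ x xs → Decidable (Between x xs)
between? x xs q = (minL x xs ℚP.≤? q) ×-dec (q ℚP.≤? maxL x xs)

multiples : List ℚ → ℕ → List ℚ
multiples A N = map (λ j → frac j A) (upTo (suc N))

rangeList : List ℚ → List ℚ
rangeList []       = []
rangeList (x ∷ xs) = 0ℚ ∷ filter (between? x xs) (multiples (x ∷ xs) (ℤ.∣ ↥ maxL x xs ∣ ℕ.* lcd (x ∷ xs)))

∈rangeList⁻ : ∀ {A q} → q ∈ rangeList A → InRange A q
∈rangeList⁻ {x ∷ xs} (here refl) = inj₁ refl
∈rangeList⁻ {x ∷ xs} (there q∈) = multiple-between (∈-filter⁻ (between? x xs) q∈)
  where
  multiple-between : ∀ {q N} → q ∈ multiples (x ∷ xs) N × Between x xs q → InRange (x ∷ xs) q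
  multiple-between {N = N} (q∈multiples , lo , hi) =
    let j , _ , q≡ = ∈-map⁻ (λ j → frac j (x ∷ xs)) {xs = upTo (suc N)} q∈multiples in inj₂ (j , q≡ , lo , hi)

∈rangeList⁺ : ∀ {A q} → InRange A q → q ∈ rangeList A
∈rangeList⁺ {x ∷ xs} (inj₁ refl) = here refl
∈rangeList⁺ {x ∷ xs} {q} (inj₂ (j , q≡ , lo , hi)) = there (∈-filter⁺ (between? x xs) q∈multiples (lo , hi))
  where
  N : ℕ
  N = ℤ.∣ ↥ maxL x xs ∣ ℕ.* lcd (x ∷ xs)
  j≤N : j ℕ.≤ N
  j≤N = frac-bound j (lcd (x ∷ xs)) {{lcd-nonZero (x ∷ xs)}} (maxL x xs) (subst (ℚ._≤ maxL x xs) q≡ hi)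
  j∈ : j ∈ upTo (suc N)
  j∈ = ∈-upTo⁺ (s≤s j≤N)
  q∈multiples : q ∈ multiples (x ∷ xs) N
  q∈multiples = subst (_∈ multiples (x ∷ xs) N) (sym q≡) (∈-map⁺ (λ j → frac j (x ∷ xs)) j∈)

-- Every formula contains an atom (it supplies the constants inside 𝓛[ρ]).
some-atom : ∀ φ → Σ AP (_∈ Atoms φ)
some-atom (atom p) = p , here refl
some-atom (¬' φ)   = some-atom φ
some-atom (φ ∧' ψ) = let p , p∈ = some-atom φ in p , ∈-++⁺ˡ p∈
some-atom (L r φ)  = some-atom φ
some-atom (M r φ)  = some-atom φ

Qs-nonneg : ∀ φ {q} → q ∈ Qs φ → 0ℚ ℚ.≤ q
Qs-nonneg (¬' φ)   q∈ = Qs-nonneg φ q∈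
Qs-nonneg (φ ∧' ψ) q∈ = [ Qs-nonneg φ , Qs-nonneg ψ ] (∈-++⁻ (Qs φ) q∈)
Qs-nonneg (L r φ) (here refl) = val-nonneg r
Qs-nonneg (L r φ) (there q∈)  = Qs-nonneg φ q∈
Qs-nonneg (M r φ) (here refl) = val-nonneg r
Qs-nonneg (M r φ) (there q∈)  = Qs-nonneg φ q∈

toℚ⁺ : ℚ → ℚ⁺
toℚ⁺ q = ⟨ q ℚ.⊔ 0ℚ , ℚP.p≤q⊔p q 0ℚ ⟩

val-toℚ⁺ : ∀ {q} → 0ℚ ℚ.≤ q → val (toℚ⁺ q) ≡ q
val-toℚ⁺ = ℚP.p≥q⇒p⊔q≡p

sublists : ∀ {A : Set} → List A → List (List A)
sublists []       = [] ∷ []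
sublists (x ∷ xs) = map (x ∷_) (sublists xs) ++ sublists xs

filter∈sublists : ∀ {A : Set} {P : A → Set} (P? : Decidable P) xs → filter P? xs ∈ sublists xs
filter∈sublists P? []       = here refl
filter∈sublists P? (x ∷ xs) with P? x
... | yes _ = ∈-++⁺ˡ (∈-map⁺ (x ∷_) (filter∈sublists P? xs))
... | no  _ = ∈-++⁺ʳ (map (x ∷_) (sublists xs)) (filter∈sublists P? xs)

module Fragment (ρ : Form) where

  private
    b : AP
    b = proj₁ (some-atom ρ)
    b∈ : b ∈ Atoms ρ
    b∈ = proj₂ (some-atom ρ)
    module R (J : List ℚ⁺) = Representatives (Atoms ρ) J b b∈

  indices : List ℚ⁺
  indices = map toℚ⁺ (rangeList (Qs ρ))

  Admissible : List ℚ⁺ → Set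
  Admissible J = rangeList (map val J) ⊆ rangeList (Qs ρ)

  admissible? : Decidable Admissible
  admissible? J = rangeList (map val J) ⊆? rangeList (Qs ρ)

  repsFor : List ℚ⁺ → List Form
  repsFor J = R.Reps J (md ρ)

  admissibleLists : List (List ℚ⁺)
  admissibleLists = filter admissible? (sublists indices)

  reps : List Form
  reps = concatMap repsFor admissibleLists

  within⇒InL : ∀ {J ψ} → Admissible J → R.Within J (md ρ) ψ → InL[ ρ ] ψ
  within⇒InL {ψ = ψ} adm (R.within a q m) =
    (λ r r∈ → InRange⇒∈R ρ r (∈rangeList⁻ (adm (∈rangeList⁺ (InRange-mono q (∈R⇒InRange ψ r r∈)))))) ,
    m , (λ p p∈ → a p∈)

  reps-in-fragment : ∀ {ψ} → ψ ∈ reps → InL[ ρ ] ψ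
  reps-in-fragment ψ∈ with J , J∈ , ψ∈J ← find (∈-concatMap⁻ repsFor {xs = admissibleLists} ψ∈) =
    within⇒InL (proj₂ (∈-filter⁻ admissible? {xs = sublists indices} J∈)) (R.reps-within J (md ρ) ψ∈J)

  indicesOf : Form → List ℚ⁺
  indicesOf φ = filter (λ r → val r ∈? Qs φ) indices

  indicesOf⊆Qs : ∀ φ → map val (indicesOf φ) ⊆ Qs φ
  indicesOf⊆Qs φ q∈ with r , r∈ , refl ← ∈-map⁻ val q∈ = proj₂ (∈-filter⁻ (λ r → val r ∈? Qs φ) {xs = indices} r∈)

  -- For φ ∈ 𝓛[ρ], every index of φ lies in R_φ ⊆ R_ρ, hence among the candidates.
  Qs⊆indicesOf : ∀ {φ} → InL[ ρ ] φ → Qs φ ⊆ map val (indicesOf φ)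
  Qs⊆indicesOf {φ} (R⊆ , _ , _) {q} q∈ =
    subst (_∈ map val (indicesOf φ)) (val-toℚ⁺ q≥0)
      (∈-map⁺ val (∈-filter⁺ (λ r → val r ∈? Qs φ) toℚ⁺q∈indices (subst (_∈ Qs φ) (sym (val-toℚ⁺ q≥0)) q∈)))
    where
    q≥0 : 0ℚ ℚ.≤ q
    q≥0 = Qs-nonneg φ q∈
    toℚ⁺q∈indices : toℚ⁺ q ∈ indices
    toℚ⁺q∈indices =
      ∈-map⁺ toℚ⁺ (∈rangeList⁺ (∈R⇒InRange ρ q (R⊆ q (InRange⇒∈R φ q (InRange-self q≥0 q∈)))))

  -- The range of the indices of φ ∈ 𝓛[ρ] is contained in R_φ ⊆ R_ρ.
  indicesOf-admissible : ∀ {φ} → InL[ ρ ] φ → Admissible (indicesOf φ)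
  indicesOf-admissible {φ} (R⊆ , _ , _) {q} q∈ =
    ∈rangeList⁺ (∈R⇒InRange ρ q (R⊆ q (InRange⇒∈R φ q (InRange-mono (indicesOf⊆Qs φ) (∈rangeList⁻ q∈)))))

  fragment-covered : ∀ {φ} → InL[ ρ ] φ → Σ Form λ ψ → ψ ∈ reps × (⊢ (φ ⇔' ψ))
  fragment-covered {φ} φ∈𝓛@(_ , m , a) =
    let ψ , ψ∈ , e = R.represent (indicesOf φ) (md ρ) φ (R.within (λ {p} → a p) (Qs⊆indicesOf φ∈𝓛) m)
        Jφ∈ = ∈-filter⁺ admissible? (filter∈sublists _ indices) (indicesOf-admissible φ∈𝓛)
    in ψ , ∈-concatMap⁺ repsFor (lose Jφ∈ ψ∈) , e

proposition4p3 : (ρ : Form) →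
    Σ (List Form) λ reps →
      All InL[ ρ ] reps ×
      ((φ : Form) → InL[ ρ ] φ → Any (λ ψ → ⊢ (φ ⇔' ψ)) reps)
proposition4p3 ρ = reps , All.tabulate reps-in-fragment , covered
  where
  open Fragment ρ
  covered : (φ : Form) → InL[ ρ ] φ → Any (λ ψ → ⊢ (φ ⇔' ψ)) reps
  covered φ φ∈𝓛 = let ψ , ψ∈ , e = fragment-covered φ∈𝓛 in lose ψ∈ e
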